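{- For every integer-pair grammar $\mathcal{G}$, there exists an insertion system that expresses $\mathcal{G}$.
   Context: An integer-pair grammar is a context-free grammar $\mathcal{G}=(\Sigma,\Gamma,\Delta,S)$ in Chomsky normal form whose non-terminal symbols are integer pairs $(a,d)$ and each of whose rules has the form $(a,d)\to(a,b)(c,d)$ or $(a,d)\to t$ with $t\in\Sigma$ terminal; $L(\mathcal{G})$ is the set of terminal strings derivable from $S$. Insertion systems: An insertion system is $\mathcal{S}=(\Sigma',\Delta',Q,R)$. Every symbol $s\in\Sigma'$ has a complement $s^*$; write $\overline{s}=s^*$, $\overline{s^*}=s$. $\Delta'$ is a set of monomer types $(a,b,c,d)^+$ or $(a,b,c,d)^-$ with entries in $\Sigma'\cup\{s^*:s\in\Sigma'\}$, each with a concentration in $(0,1]$, summing to at most $1$. $Q=(a,b)$, $R=(c,d)$ form the initiator, with $\overline a=d$ or $\overline b=c$. A polymer is a sequence $Qm_1\cdots m_nR$; each pair of adjacent monomer ends $(a,b)(c,d)$ is an insertion site. Into a site $(a,b)(c,d)$: if $\overline a=d$, any $(\overline b,e,f,\overline c)^+$ can be inserted; if $\overline b=c$, any $(e,\overline a,\overline d,f)^-$ can be inserted. Constructed polymers: the initiator and anything obtained by an insertion into a constructed polymer. Terminal: no insertion possible. String representation: the sequence of symbols left to right. $L(\mathcal{S})$: string representations of terminal polymers. Expression: $\mathcal{S}$ expresses a grammar $\mathcal{G}$ with terminals $\Sigma$ if there exist $g:\Sigma'\cup\{s^*:s\in\Sigma'\}\to\Sigma\cup\{\varepsilon\}$ and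 a fixed integer $\kappa$ with $\{g(s_1')\cdots g(s_n'): s_1'\cdots s_n'\in L(\mathcal{S})\}=L(\mathcal{G})$ and such that for every substring $s_{i+1}'\cdots s_{i+\kappa}'$ of a string in $L(\mathcal{S})$, $\{g(s_{i+1}'),\dots,g(s_{i+\kappa}')\}\neq\{\varepsilon\}$. -}

module Defs where

open import Data.Nat using (ℕ; zero; suc; _≥_)
open import Data.Integer using (ℤ)
open import Data.Fin using (Fin)
open import Data.Bool using (Bool; true; false; not)
open import Data.Maybe using (Maybe; just; nothing; Is-just)
open import Data.List using (List; []; _∷_; _++_; concatMap; length; foldr; map; mapMaybe)
open import Data.List.Membership.Propositional using (_∈_)
open import Data.List.Relation.Unary.All using (All)
open import Data.List.Relation.Unary.Any using (Any)
open import Data.Product using (Σ; ∃; ∃-syntax; _×_; _,_; proj₁; proj₂)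
open import Data.Sum using (_⊎_)
open import Data.Rational using (ℚ; 0ℚ; 1ℚ; _+_; _<_; _≤_)
open import Relation.Binary.PropositionalEquality using (_≡_)
open import Relation.Nullary using (¬_)
open import Relation.Binary.Construct.Closure.ReflexiveTransitive using (Star)
open import Function.Bundles using (_⇔_)

NT : Set
NT = ℤ × ℤ

-- binary a b c d  :  (a,d) → (a,b)(c,d)
-- unary  a d t    :  (a,d) → t
data Rule (m : ℕ) : Set where
  binary : (a b c d : ℤ) → Rule m
  unary  : (a d : ℤ) → Fin m → Rule m

ruleNTs : ∀ {m} → Rule m → List NT
ruleNTs (binary a b c d) = (a , d) ∷ (a , b) ∷ (c , d) ∷ []
ruleNTs (unary a d t)    = (a , d) ∷ []

record IPGrammar (m : ℕ) : Set where
  field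
    Γ      : List NT
    Δ      : List (Rule m)
    S      : NT
    S∈Γ    : S ∈ Γ
    rulesΓ : All (λ r → All (λ x → x ∈ Γ) (ruleNTs r)) Δ

data Derives {m : ℕ} (G : IPGrammar m) : NT → List (Fin m) → Set where
  der-unary  : ∀ {a d t} → unary a d t ∈ IPGrammar.Δ G →
               Derives G (a , d) (t ∷ [])
  der-binary : ∀ {a b c d u v} → binary a b c d ∈ IPGrammar.Δ G →
               Derives G (a , b) u → Derives G (c , d) v →
               Derives G (a , d) (u ++ v)

InLangG : ∀ {m} → IPGrammar m → List (Fin m) → Set
InLangG G w = Derives G (IPGrammar.S G) w

-- symbols of Σ' ∪ {s* : s ∈ Σ'}; (s , true) stands for s*
Sym : ℕ → Set
Sym k = Fin k × Bool

comp : ∀ {k} → Sym k → Sym k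
comp (s , b) = (s , not b)

data Sign : Set where
  plus minus : Sign

record Monomer (k : ℕ) : Set where
  constructor mono
  field
    ma mb mc md : Sym k
    sign        : Sign

End : ℕ → Set
End k = Sym k × Sym k

leftEnd : ∀ {k} → Monomer k → End k
leftEnd m = Monomer.ma m , Monomer.mb m

rightEnd : ∀ {k} → Monomer k → End k
rightEnd m = Monomer.mc m , Monomer.md m

sumℚ : List ℚ → ℚ
sumℚ = foldr _+_ 0ℚ

record InsSystem (k : ℕ) : Set where
  field
    Δ'    : List (Monomer k × ℚ)
    conc-pos : All (λ p → 0ℚ < proj₂ p) Δ'
    conc-le1 : All (λ p → proj₂ p ≤ 1ℚ) Δ'
    conc-sum : sumℚ (map proj₂ Δ') ≤ 1ℚ
    Q     : End k
    R     : End k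
    initiator-ok : (comp (proj₁ Q) ≡ proj₂ R) ⊎ (comp (proj₂ Q) ≡ proj₁ R)

IsType : ∀ {k} → InsSystem k → Monomer k → Set
IsType S m = Any (λ p → proj₁ p ≡ m) (InsSystem.Δ' S)

-- a polymer Q m₁ ⋯ mₙ R is represented by the list m₁ ⋯ mₙ
Polymer : ℕ → Set
Polymer k = List (Monomer k)

-- the end to the left of a site, after Q followed by xs
endLeftOf : ∀ {k} → End k → Polymer k → End k
endLeftOf e []       = e
endLeftOf e (x ∷ xs) = endLeftOf (rightEnd x) xs

-- the end to the right of a site, before ys followed by R
endRightOf : ∀ {k} → End k → Polymer k → End k
endRightOf e []       = e
endRightOf e (y ∷ ys) = leftEnd y

CanInsert : ∀ {k} → End k → End k → Monomer k → Set
CanInsert (a , b) (c , d) m =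
    (comp a ≡ d × Monomer.sign m ≡ plus ×
       Monomer.ma m ≡ comp b × Monomer.md m ≡ comp c)
  ⊎ (comp b ≡ c × Monomer.sign m ≡ minus ×
       Monomer.mb m ≡ comp a × Monomer.mc m ≡ comp d)

data Step {k : ℕ} (S : InsSystem k) : Polymer k → Polymer k → Set where
  insert : ∀ xs ys m → IsType S m →
           CanInsert (endLeftOf (InsSystem.Q S) xs) (endRightOf (InsSystem.R S) ys) m →
           Step S (xs ++ ys) (xs ++ m ∷ ys)

Constructed : ∀ {k} → InsSystem k → Polymer k → Set
Constructed S P = Star (Step S) [] P

Terminal : ∀ {k} → InsSystem k → Polymer k → Set
Terminal S P = ¬ (∃[ P' ] Step S P P')

monoSyms : ∀ {k} → Monomer k → List (Sym k)
monoSyms (mono a b c d _) = a ∷ b ∷ c ∷ d ∷ []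

stringRep : ∀ {k} → InsSystem k → Polymer k → List (Sym k)
stringRep S P =
  (proj₁ (InsSystem.Q S) ∷ proj₂ (InsSystem.Q S) ∷ [])
  ++ concatMap monoSyms P
  ++ (proj₁ (InsSystem.R S) ∷ proj₂ (InsSystem.R S) ∷ [])

InLangS : ∀ {k} → InsSystem k → List (Sym k) → Set
InLangS S s = ∃[ P ] (Constructed S P × Terminal S P × stringRep S P ≡ s)

-- Expression (ε is represented by nothing)

Expresses : ∀ {k m} → InsSystem k → IPGrammar m → Set
Expresses {k} {m} S G =
  Σ (Sym k → Maybe (Fin m)) λ g → Σ ℕ λ κ →
    κ ≥ 1 ×
    (∀ w → InLangG G w ⇔ (∃[ s ] (InLangS S s × mapMaybe g s ≡ w))) ×
    (∀ s u v w → InLangS S s → s ≡ u ++ v ++ w → length v ≡ κ →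
       Any (λ x → Is-just (g x)) v)

module Submission where

-- A non-terminal (a,d) is represented by a "region", the site
-- (int a , hole)(hole* , int d).  A binary rule (a,d) → (a,b)(c,d) is a monomer
-- fitting exactly the regions of (a,d); two further monomers turn its new sites
-- into regions for (a,b) and (c,d).  A unary rule (a,d) → t is a monomer carrying
-- t and leaving dead sites.  A trap monomer fits every region and starts an
-- endless insertion chain, so terminal polymers have no unexpanded region.

open import Defs
open import Data.Nat using (ℕ; zero; suc; _+_; _≤_; _<_; z≤n; s≤s; _≡ᵇ_)
import Data.Nat.Properties as ℕₚ
open import Data.Integer using (ℤ; 0ℤ)
import Data.Integer.Properties as ℤₚ
open import Data.Fin using (Fin; zero; suc)
open import Data.Fin.Properties using (+↔⊎)
open import Data.Bool using (Bool; true; false; not; T; _∧_; _∨_)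
open import Data.Bool.Properties using (T-∧; T-∨)
open import Data.Maybe using (Maybe; just; nothing; Is-just; maybe′)
import Data.Maybe.Relation.Unary.Any as MaybeAny
open import Data.List using (List; []; _∷_; _++_; length; foldl; map; concatMap; mapMaybe; lookup)
open import Data.List.Properties
  using (++-assoc; ++-identityʳ; ∷-injectiveˡ; ∷-injectiveʳ; foldl-++; concatMap-++; mapMaybe-++)
open import Data.List.Membership.Propositional using (_∈_; find)
open import Data.List.Membership.Propositional.Properties
  using (∈-++⁺ˡ; ∈-++⁺ʳ; ∈-++⁻; ∈-concatMap⁺; ∈-concatMap⁻; ∈-map⁺; ∈-map⁻)
open import Data.List.Relation.Unary.All as All using (All; []; _∷_)
import Data.List.Relation.Unary.All.Properties as Allₚ
open import Data.List.Relation.Unary.Any as Any using (Any; here; there; index)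
import Data.List.Relation.Unary.Any.Properties as Anyₚ
open import Data.Product using (Σ; ∃-syntax; _×_; _,_; proj₁; proj₂)
open import Data.Sum using (_⊎_; inj₁; inj₂)
open import Data.Sum.Function.Propositional using (_⊎-↔_)
open import Data.Unit using (⊤; tt)
open import Data.Empty using (⊥; ⊥-elim)
open import Function.Bundles using (_↔_; _⇔_; mk⇔; Inverse; Equivalence)
open import Function.Properties.Inverse using (↔-refl; ↔-trans)
open import Relation.Nullary using (¬_; yes; no)
open import Relation.Nullary.Negation using (contradiction)
open import Relation.Nullary.Decidable using (toWitness)
open import Relation.Binary.PropositionalEquality
  using (_≡_; refl; sym; trans; cong; cong₂; subst; subst₂; module ≡-Reasoning)
open import Relation.Binary.Construct.Closure.ReflexiveTransitive using (Star; ε; _◅_; _◅◅_)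

-- Any list of monomer types can be given admissible concentrations:
-- the i-th entry gets 2⁻⁽ⁱ⁺¹⁾, so that all are in (0, ½] and they sum to less than 1.
module Concentrations {A : Set} where
  open import Data.Rational as ℚ using (ℚ; 0ℚ; 1ℚ; ½; _*_)
  import Data.Rational.Properties as ℚₚ

  halve : A × ℚ → A × ℚ
  halve (x , q) = x , ½ * q

  withConcentrations : List A → List (A × ℚ)
  withConcentrations []       = []
  withConcentrations (x ∷ xs) = (x , ½) ∷ map halve (withConcentrations xs)

  ½≤1 : ½ ℚ.≤ 1ℚ
  ½≤1 = toWitness {a? = ½ ℚₚ.≤? 1ℚ} _

  halve-pos : ∀ {q} → 0ℚ ℚ.< q → 0ℚ ℚ.< ½ * q
  halve-pos {q} 0<q = subst (ℚ._< ½ * q) (ℚₚ.*-zeroʳ ½) (ℚₚ.*-monoʳ-<-pos ½ 0<q)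

  halve-≤½ : ∀ {q} → q ℚ.≤ 1ℚ → ½ * q ℚ.≤ ½
  halve-≤½ q≤1 = ℚₚ.≤-trans (ℚₚ.*-monoˡ-≤-nonNeg ½ q≤1) (ℚₚ.≤-reflexive (ℚₚ.*-identityʳ ½))

  sum-halve : (ps : List (A × ℚ)) →
              sumℚ (map proj₂ (map halve ps)) ≡ ½ * sumℚ (map proj₂ ps)
  sum-halve []       = sym (ℚₚ.*-zeroʳ ½)
  sum-halve (p ∷ ps) rewrite sum-halve ps = sym (ℚₚ.*-distribˡ-+ ½ (proj₂ p) _)

  concentrations-pos : (xs : List A) → All (λ p → 0ℚ ℚ.< proj₂ p) (withConcentrations xs)
  concentrations-pos []       = []
  concentrations-pos (x ∷ xs) =
    ℚₚ.positive⁻¹ ½ ∷ Allₚ.map⁺ (All.map halve-pos (concentrations-pos xs))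

  concentrations-≤1 : (xs : List A) → All (λ p → proj₂ p ℚ.≤ 1ℚ) (withConcentrations xs)
  concentrations-≤1 []       = []
  concentrations-≤1 (x ∷ xs) =
    ½≤1 ∷ Allₚ.map⁺ (All.map (λ q≤1 → ℚₚ.≤-trans (halve-≤½ q≤1) ½≤1) (concentrations-≤1 xs))

  -- the total is ½ + ½·(total of the tail) ≤ ½ + ½ = 1
  concentrations-sum : (xs : List A) → sumℚ (map proj₂ (withConcentrations xs)) ℚ.≤ 1ℚ
  concentrations-sum []       = toWitness {a? = 0ℚ ℚₚ.≤? 1ℚ} _
  concentrations-sum (x ∷ xs) rewrite sum-halve (withConcentrations xs) =
    ℚₚ.+-monoʳ-≤ ½ (halve-≤½ (concentrations-sum xs))

  ∈⇒typed : ∀ {x} xs → x ∈ xs → Any (λ p → proj₁ p ≡ x) (withConcentrations xs)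
  ∈⇒typed (y ∷ xs) (here x≡y) = here (sym x≡y)
  ∈⇒typed (y ∷ xs) (there x∈) = there (Anyₚ.map⁺ (∈⇒typed xs x∈))

  typed⇒∈ : ∀ {x} xs → Any (λ p → proj₁ p ≡ x) (withConcentrations xs) → x ∈ xs
  typed⇒∈ (y ∷ xs) (here y≡x) = here (sym y≡x)
  typed⇒∈ (y ∷ xs) (there t)  = there (typed⇒∈ xs (Anyₚ.map⁻ t))

-- We read a string left to right with a counter of
-- consecutive erased symbols; the string is dense if the counter never exceeds
-- `bound`, and then every window of bound + 1 symbols carries a letter.
module Density {A B : Set} (g : A → Maybe B) (bound : ℕ) where

  Erased : A → Set
  Erased x = g x ≡ nothing

  tick : ℕ → A → ℕ
  tick n x = maybe′ (λ _ → 0) (suc n) (g x)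

  counter : ℕ → List A → ℕ
  counter = foldl tick

  Bounded : ℕ → List A → Set
  Bounded n []       = ⊤
  Bounded n (x ∷ xs) = tick n x ≤ bound × Bounded (tick n x) xs

  Bounded-++ : ∀ n xs ys → Bounded n xs → Bounded (counter n xs) ys → Bounded n (xs ++ ys)
  Bounded-++ n []       ys _          b = b
  Bounded-++ n (x ∷ xs) ys (le , bxs) b = le , Bounded-++ (tick n x) xs ys bxs b

  Bounded-++⁻ : ∀ n xs ys → n ≤ bound → Bounded n (xs ++ ys) →
                counter n xs ≤ bound × Bounded (counter n xs) ys
  Bounded-++⁻ n []       ys n≤ b         = n≤ , b
  Bounded-++⁻ n (x ∷ xs) ys n≤ (le , b) = Bounded-++⁻ (tick n x) xs ys le b

  counter-++ : ∀ n xs ys → counter n (xs ++ ys) ≡ counter (counter n xs) ys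
  counter-++ n xs ys = foldl-++ tick n xs ys

  window : ∀ n v w → n ≤ bound → Bounded n (v ++ w) → bound < n + length v →
           Any (λ x → Is-just (g x)) v
  window n []      w n≤ b n+0> = ⊥-elim (ℕₚ.<⇒≱ n+0> (subst (_≤ bound) (sym (ℕₚ.+-identityʳ n)) n≤))
  window n (x ∷ v) w n≤ b n+v> with g x in gx
  ... | just _  = here (subst Is-just (sym gx) (MaybeAny.just tt))
  ... | nothing = there (window (suc n) v w (proj₁ b) (proj₂ b)
                          (subst (bound <_) (ℕₚ.+-suc n (length v)) n+v>))

  dense : ∀ s → Bounded 0 s → ∀ u v w → s ≡ u ++ v ++ w → length v ≡ suc bound →
          Any (λ x → Is-just (g x)) v
  dense s b u v w refl |v| with Bounded-++⁻ 0 u (v ++ w) z≤n b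
  ... | c≤ , bv = window (counter 0 u) v w c≤ bv
                    (subst (λ l → bound < counter 0 u + l) (sym |v|) (ℕₚ.m≤n+m _ _))

  -- Good s e xs: from any counter ≤ s, xs is read boundedly and leaves the counter ≤ e.
  -- This is the compositional form of density used on the pieces of a polymer.
  Good : ℕ → ℕ → List A → Set
  Good s e xs = ∀ n → n ≤ s → Bounded n xs × counter n xs ≤ e

  Good-++ : ∀ {s₁ e₁ s₂ e₂} xs ys → Good s₁ e₁ xs → Good s₂ e₂ ys → e₁ ≤ s₂ → Good s₁ e₂ (xs ++ ys)
  Good-++ xs ys gxs gys e₁≤s₂ n n≤ =
    let (bxs , cxs) = gxs n n≤
        (bys , cys) = gys (counter n xs) (ℕₚ.≤-trans cxs e₁≤s₂)
    in Bounded-++ n xs ys bxs bys , subst (_≤ _) (sym (counter-++ n xs ys)) cys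

  counter-erased : ∀ n xs → All Erased xs → counter n xs ≡ n + length xs
  counter-erased n []       []         = sym (ℕₚ.+-identityʳ n)
  counter-erased n (x ∷ xs) (gx ∷ exs) rewrite gx =
    trans (counter-erased (suc n) xs exs) (sym (ℕₚ.+-suc n (length xs)))

  Bounded-erased : ∀ n xs → All Erased xs → n + length xs ≤ bound → Bounded n xs
  Bounded-erased n []       []         _ = tt
  Bounded-erased n (x ∷ xs) (gx ∷ exs) le rewrite gx =
    ℕₚ.≤-trans (s≤s (ℕₚ.m≤m+n n (length xs))) le' , Bounded-erased (suc n) xs exs le'
    where le' = subst (_≤ bound) (ℕₚ.+-suc n (length xs)) le

  Good-erased : ∀ s xs → All Erased xs → s + length xs ≤ bound → Good s (s + length xs) xs
  Good-erased s xs exs le n n≤s =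
    Bounded-erased n xs exs (ℕₚ.≤-trans n+ le) ,
    subst (_≤ s + length xs) (sym (counter-erased n xs exs)) n+
    where n+ = ℕₚ.+-monoˡ-≤ (length xs) n≤s

  Good-letter : ∀ {s e x b} xs → g x ≡ just b → Good 0 e xs → Good s e (x ∷ xs)
  Good-letter xs gx gxs n _ rewrite gx = (z≤n , proj₁ (gxs 0 z≤n)) , proj₂ (gxs 0 z≤n)

  erase : ∀ xs → All Erased xs → mapMaybe g xs ≡ []
  erase []       []         = refl
  erase (x ∷ xs) (gx ∷ exs) rewrite gx = erase xs exs

cut-++-∷ : ∀ {A : Set} (xs ys P₁ : List A) (m : A) (P₂ : List A) → xs ++ ys ≡ P₁ ++ m ∷ P₂ →
           (∃[ ys₁ ] P₁ ≡ xs ++ ys₁ × ys ≡ ys₁ ++ m ∷ P₂) ⊎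
           (∃[ xs₂ ] xs ≡ P₁ ++ m ∷ xs₂ × P₂ ≡ xs₂ ++ ys)
cut-++-∷ []       ys P₁       m P₂ eq   = inj₁ (P₁ , refl , eq)
cut-++-∷ (x ∷ xs) ys []       m P₂ refl = inj₂ (xs , refl , refl)
cut-++-∷ (x ∷ xs) ys (p ∷ P₁) m P₂ eq
  with refl ← ∷-injectiveˡ eq | cut-++-∷ xs ys P₁ m P₂ (∷-injectiveʳ eq)
... | inj₁ (ys₁ , e₁ , e₂) = inj₁ (ys₁ , cong (x ∷_) e₁ , e₂)
... | inj₂ (xs₂ , e₁ , e₂) = inj₂ (xs₂ , cong (x ∷_) e₁ , e₂)

-- Every insertion splits a site into two sites, so a
-- constructed polymer is the frontier of a binary tree whose nodes are the
-- inserted monomers; the polymer is terminal iff every leaf site is closed.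
-- This lets us reason about L(S) by structural induction on trees instead of
-- on insertion sequences.
module InsertionTrees {k : ℕ} (S : InsSystem k) where
  open InsSystem S

  data Tree (Leaf : End k → End k → Set) : End k → End k → Polymer k → Set where
    leaf : ∀ {eL eR} → Leaf eL eR → Tree Leaf eL eR []
    node : ∀ {eL eR m P₁ P₂} → IsType S m → CanInsert eL eR m →
           Tree Leaf eL (leftEnd m) P₁ → Tree Leaf (rightEnd m) eR P₂ →
           Tree Leaf eL eR (P₁ ++ m ∷ P₂)

  Closed : End k → End k → Set
  Closed eL eR = ∀ m → IsType S m → ¬ CanInsert eL eR m

  AnyTree : End k → End k → Polymer k → Set
  AnyTree = Tree (λ _ _ → ⊤)

  ClosedTree : End k → End k → Polymer k → Set
  ClosedTree = Tree Closed

  forget : ∀ {eL eR P} → ClosedTree eL eR P → AnyTree eL eR P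
  forget (leaf _)         = leaf tt
  forget (node t c tl tr) = node t c (forget tl) (forget tr)

  endLeftOf-∷ : ∀ (e : End k) xs m (ys : Polymer k) → endLeftOf e (xs ++ m ∷ ys) ≡ endLeftOf (rightEnd m) ys
  endLeftOf-∷ e []       m ys = refl
  endLeftOf-∷ e (x ∷ xs) m ys = endLeftOf-∷ (rightEnd x) xs m ys

  endRightOf-∷ : ∀ (e : End k) ys m (P : Polymer k) → endRightOf e (ys ++ m ∷ P) ≡ endRightOf (leftEnd m) ys
  endRightOf-∷ e []      m P = refl
  endRightOf-∷ e (_ ∷ _) m P = refl

  insertAt : ∀ {eL eR P} → AnyTree eL eR P → ∀ xs ys m → P ≡ xs ++ ys → IsType S m →
             CanInsert (endLeftOf eL xs) (endRightOf eR ys) m → AnyTree eL eR (xs ++ m ∷ ys)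
  insertAt (leaf _) []      []      m _  t c = node t c (leaf tt) (leaf tt)
  insertAt {eL} {eR} (node {m = m₀} {P₁} {P₂} t₀ c₀ tl tr) xs ys m eq t c
    with cut-++-∷ xs ys P₁ m₀ P₂ (sym eq)
  ... | inj₁ (ys₁ , refl , refl) =
    subst (AnyTree eL eR) (++-assoc xs (m ∷ ys₁) (m₀ ∷ P₂))
      (node t₀ c₀ (insertAt tl xs ys₁ m refl t c′) tr)
    where c′ = subst (λ e → CanInsert (endLeftOf eL xs) e m) (endRightOf-∷ eR ys₁ m₀ P₂) c
  ... | inj₂ (xs₂ , refl , refl) =
    subst (AnyTree eL eR) (sym (++-assoc P₁ (m₀ ∷ xs₂) (m ∷ ys)))
      (node t₀ c₀ tl (insertAt tr xs₂ ys m refl t c′))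
    where c′ = subst (λ e → CanInsert e (endRightOf eR ys) m) (endLeftOf-∷ eL P₁ m₀ xs₂) c

  constructed⇒tree : ∀ {P} → Constructed S P → AnyTree Q R P
  constructed⇒tree = go (leaf tt)
    where
      go : ∀ {P₀ P} → AnyTree Q R P₀ → Star (Step S) P₀ P → AnyTree Q R P
      go t ε                              = t
      go t (insert xs ys m ty c ◅ steps) = go (insertAt t xs ys m refl ty c) steps

  cut-after-root : ∀ (xs P₁ : Polymer k) m zs → ((xs ++ P₁) ++ m ∷ []) ++ zs ≡ xs ++ P₁ ++ m ∷ zs
  cut-after-root xs P₁ m zs = trans (++-assoc (xs ++ P₁) (m ∷ []) zs) (++-assoc xs P₁ (m ∷ zs))

  frontier-split : ∀ (xs P₁ : Polymer k) m P₂ ys → xs ++ (P₁ ++ m ∷ P₂) ++ ys ≡ xs ++ P₁ ++ m ∷ P₂ ++ ys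
  frontier-split xs P₁ m P₂ ys = cong (xs ++_) (++-assoc P₁ (m ∷ P₂) ys)

  -- a tree sitting at the cut xs | ys can be grown by inserting its root first,
  -- then its left subtree, then its right subtree
  grow : ∀ {eL eR P} → AnyTree eL eR P → ∀ xs ys → endLeftOf Q xs ≡ eL → endRightOf R ys ≡ eR →
         Star (Step S) (xs ++ ys) (xs ++ P ++ ys)
  grow (leaf _) xs ys _ _ = ε
  grow (node {m = m} {P₁} {P₂} t c tl tr) xs ys refl refl =
    insert xs ys m t c ◅ (grow tl xs (m ∷ ys) refl refl ◅◅ right)
    where
      right : Star (Step S) (xs ++ P₁ ++ m ∷ ys) (xs ++ (P₁ ++ m ∷ P₂) ++ ys)
      right = subst₂ (Star (Step S)) (cut-after-root xs P₁ m ys)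
                (trans (cut-after-root xs P₁ m (P₂ ++ ys)) (sym (frontier-split xs P₁ m P₂ ys)))
                (grow tr ((xs ++ P₁) ++ m ∷ []) ys (endLeftOf-∷ Q (xs ++ P₁) m []) refl)

  tree⇒constructed : ∀ {P} → AnyTree Q R P → Constructed S P
  tree⇒constructed {P} t = subst (Star (Step S) []) (++-identityʳ P) (grow t [] [] refl refl)

  close : ∀ {eL eR P} → AnyTree eL eR P → ∀ xs ys → endLeftOf Q xs ≡ eL → endRightOf R ys ≡ eR →
          Terminal S (xs ++ P ++ ys) → ClosedTree eL eR P
  close (leaf _) xs ys refl refl term = leaf (λ m t c → term (_ , insert xs ys m t c))
  close (node {m = m} {P₁} {P₂} t c tl tr) xs ys refl refl term =
    node t c (close tl xs (m ∷ P₂ ++ ys) refl refl (subst (Terminal S) (frontier-split xs P₁ m P₂ ys) term))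
             (close tr ((xs ++ P₁) ++ m ∷ []) ys (endLeftOf-∷ Q (xs ++ P₁) m []) refl
                (subst (Terminal S) (trans (frontier-split xs P₁ m P₂ ys) (sym (cut-after-root xs P₁ m (P₂ ++ ys)))) term))

  terminal⇒closedTree : ∀ {P} → AnyTree Q R P → Terminal S P → ClosedTree Q R P
  terminal⇒closedTree {P} t term = close t [] [] refl refl (subst (Terminal S) (sym (++-identityʳ P)) term)

  closedAt : ∀ {eL eR P} → ClosedTree eL eR P → ∀ xs ys → xs ++ ys ≡ P → ∀ m → IsType S m →
             ¬ CanInsert (endLeftOf eL xs) (endRightOf eR ys) m
  closedAt (leaf cl) [] [] _ m t c = cl m t c
  closedAt {eL} {eR} (node {m = m₀} {P₁} {P₂} _ _ tl tr) xs ys eq m t c with cut-++-∷ xs ys P₁ m₀ P₂ eq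
  ... | inj₁ (ys₁ , refl , refl) =
    closedAt tl xs ys₁ refl m t (subst (λ e → CanInsert (endLeftOf eL xs) e m) (endRightOf-∷ eR ys₁ m₀ P₂) c)
  ... | inj₂ (xs₂ , refl , refl) =
    closedAt tr xs₂ ys refl m t (subst (λ e → CanInsert e (endRightOf eR ys) m) (endLeftOf-∷ eL P₁ m₀ xs₂) c)

  closedTree⇒terminal : ∀ {P} → ClosedTree Q R P → Terminal S P
  closedTree⇒terminal t (_ , insert xs ys m ty c) = closedAt t xs ys refl m ty c

-- Codes for the integers of a finite list: 0 for "unknown", suc i for the i-th entry.
module IntegerCodes (Zs : List ℤ) where
  open import Data.List.Membership.DecPropositional ℤₚ._≟_ using (_∈?_)

  code : ℤ → Fin (suc (length Zs))
  code x with x ∈? Zs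
  ... | yes x∈ = suc (index x∈)
  ... | no _   = zero

  decode : Fin (suc (length Zs)) → ℤ
  decode zero    = 0ℤ
  decode (suc i) = lookup Zs i

  decode-code : ∀ {x} → x ∈ Zs → decode (code x) ≡ x
  decode-code {x} x∈ with x ∈? Zs
  ... | yes x∈′ = sym (Anyₚ.lookup-index x∈′)
  ... | no x∉   = contradiction x∈ x∉

module Alphabet (m : ℕ) (Zs : List ℤ) where
  open IntegerCodes Zs

  -- int a: the integer a itself; lft b / rgt c: the ends of a binary monomer
  -- facing its left / right child; ter t: carries the terminal t;
  -- hole, pad: structural symbols; trap, loop: symbols of the trap gadget
  data Letter : Set where
    int lft rgt : ℤ → Letter
    ter         : Fin m → Letter
    hole pad trap loop : Letter

  -- letters whose integer occurs in Zs: on them the coding is injective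
  Known : Letter → Set
  Known (int x) = x ∈ Zs
  Known (lft x) = x ∈ Zs
  Known (rgt x) = x ∈ Zs
  Known _       = ⊤

  N : ℕ
  N = suc (length Zs)

  Code : Set
  Code = Fin 4 ⊎ (Fin N ⊎ (Fin N ⊎ (Fin N ⊎ Fin m)))

  toCode : Letter → Code
  toCode hole    = inj₁ zero
  toCode pad     = inj₁ (suc zero)
  toCode trap    = inj₁ (suc (suc zero))
  toCode loop    = inj₁ (suc (suc (suc zero)))
  toCode (int x) = inj₂ (inj₁ (code x))
  toCode (lft x) = inj₂ (inj₂ (inj₁ (code x)))
  toCode (rgt x) = inj₂ (inj₂ (inj₂ (inj₁ (code x))))
  toCode (ter t) = inj₂ (inj₂ (inj₂ (inj₂ t)))

  fromCode : Code → Letter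
  fromCode (inj₁ zero)                   = hole
  fromCode (inj₁ (suc zero))             = pad
  fromCode (inj₁ (suc (suc zero)))       = trap
  fromCode (inj₁ (suc (suc (suc _))))    = loop
  fromCode (inj₂ (inj₁ i))               = int (decode i)
  fromCode (inj₂ (inj₂ (inj₁ i)))        = lft (decode i)
  fromCode (inj₂ (inj₂ (inj₂ (inj₁ i)))) = rgt (decode i)
  fromCode (inj₂ (inj₂ (inj₂ (inj₂ t)))) = ter t

  fromCode-toCode : ∀ x → Known x → fromCode (toCode x) ≡ x
  fromCode-toCode (int x) x∈ = cong int (decode-code x∈)
  fromCode-toCode (lft x) x∈ = cong lft (decode-code x∈)
  fromCode-toCode (rgt x) x∈ = cong rgt (decode-code x∈)
  fromCode-toCode (ter t) _  = refl
  fromCode-toCode hole    _  = refl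
  fromCode-toCode pad     _  = refl
  fromCode-toCode trap    _  = refl
  fromCode-toCode loop    _  = refl

  terminal : Letter → Maybe (Fin m)
  terminal (ter t) = just t
  terminal _       = nothing

  terminal-fromCode-toCode : ∀ x → terminal (fromCode (toCode x)) ≡ terminal x
  terminal-fromCode-toCode (int _) = refl
  terminal-fromCode-toCode (lft _) = refl
  terminal-fromCode-toCode (rgt _) = refl
  terminal-fromCode-toCode (ter _) = refl
  terminal-fromCode-toCode hole    = refl
  terminal-fromCode-toCode pad     = refl
  terminal-fromCode-toCode trap    = refl
  terminal-fromCode-toCode loop    = refl

  K : ℕ
  K = 4 + (N + (N + (N + m)))

  finCode : Fin K ↔ Code
  finCode = ↔-trans +↔⊎ (↔-refl ⊎-↔ ↔-trans +↔⊎ (↔-refl ⊎-↔ ↔-trans +↔⊎ (↔-refl ⊎-↔ +↔⊎)))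

  enc : Letter → Fin K
  enc x = Inverse.from finCode (toCode x)

  dec : Fin K → Letter
  dec i = fromCode (Inverse.to finCode i)

  dec-enc : ∀ x → dec (enc x) ≡ fromCode (toCode x)
  dec-enc x = cong fromCode (Inverse.strictlyInverseˡ finCode (toCode x))

  enc-injective : ∀ x y → Known x → Known y → enc x ≡ enc y → x ≡ y
  enc-injective x y kx ky e = begin
    x                     ≡⟨ sym (fromCode-toCode x kx) ⟩
    fromCode (toCode x)   ≡⟨ sym (dec-enc x) ⟩
    dec (enc x)           ≡⟨ cong dec e ⟩
    dec (enc y)           ≡⟨ dec-enc y ⟩
    fromCode (toCode y)   ≡⟨ fromCode-toCode y ky ⟩
    y                     ∎
    where open ≡-Reasoning

  terminal-dec-enc : ∀ x → terminal (dec (enc x)) ≡ terminal x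
  terminal-dec-enc x = trans (cong terminal (dec-enc x)) (terminal-fromCode-toCode x)

integers : List NT → List ℤ
integers = concatMap (λ x → proj₁ x ∷ proj₂ x ∷ [])

∈-integers₁ : ∀ {x xs} → x ∈ xs → proj₁ x ∈ integers xs
∈-integers₁ (here refl) = here refl
∈-integers₁ (there x∈)  = there (there (∈-integers₁ x∈))

∈-integers₂ : ∀ {x xs} → x ∈ xs → proj₂ x ∈ integers xs
∈-integers₂ (here refl) = there (here refl)
∈-integers₂ (there x∈)  = there (there (∈-integers₂ x∈))

∈-concatMap-at : ∀ {A B : Set} {f : A → List B} {x y xs} → x ∈ xs → y ∈ f x → y ∈ concatMap f xs
∈-concatMap-at {f = f} x∈ y∈ = ∈-concatMap⁺ f (Any.map (λ { refl → y∈ }) x∈)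

module Construction (m : ℕ) (G : IPGrammar m) where
  open IPGrammar G
  open Alphabet m (integers Γ) public

  known₁ : ∀ {x} → x ∈ Γ → Known (int (proj₁ x))
  known₁ = ∈-integers₁

  known₂ : ∀ {x} → x ∈ Γ → Known (int (proj₂ x))
  known₂ = ∈-integers₂

  lhs∈Γ : ∀ {a b c d} → binary a b c d ∈ Δ → (a , d) ∈ Γ
  lhs∈Γ r∈ with All.lookup rulesΓ r∈
  ... | x∈ ∷ _ = x∈

  leftChild∈Γ : ∀ {a b c d} → binary a b c d ∈ Δ → (a , b) ∈ Γ
  leftChild∈Γ r∈ with All.lookup rulesΓ r∈
  ... | _ ∷ x∈ ∷ _ = x∈

  rightChild∈Γ : ∀ {a b c d} → binary a b c d ∈ Δ → (c , d) ∈ Γ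
  rightChild∈Γ r∈ with All.lookup rulesΓ r∈
  ... | _ ∷ _ ∷ x∈ ∷ _ = x∈

  unary∈Γ : ∀ {a d t} → unary a d t ∈ Δ → (a , d) ∈ Γ
  unary∈Γ r∈ with All.lookup rulesΓ r∈
  ... | x∈ ∷ _ = x∈

  Symb : Set
  Symb = Letter × Bool

  ○_ ●_ : Letter → Symb
  ○ x = x , false
  ● x = x , true

  cmp : Symb → Symb
  cmp (x , b) = x , not b

  SEnd : Set
  SEnd = Symb × Symb

  record SMonomer : Set where
    constructor smono
    field sa sb sc sd : Symb
          ssign       : Sign
  open SMonomer

  Site : Set
  Site = SEnd × SEnd

  Insertable : Site → SMonomer → Set
  Insertable ((a , b) , (c , d)) mm =
      (cmp a ≡ d × ssign mm ≡ plus  × sa mm ≡ cmp b × sd mm ≡ cmp c)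
    ⊎ (cmp b ≡ c × ssign mm ≡ minus × sb mm ≡ cmp a × sc mm ≡ cmp d)

  ιs : Symb → Sym K
  ιs (x , b) = enc x , b

  ιE : SEnd → End K
  ιE (s , s′) = ιs s , ιs s′

  ιM : SMonomer → Monomer K
  ιM (smono a b c d σ) = mono (ιs a) (ιs b) (ιs c) (ιs d) σ

  KnownS : Symb → Set
  KnownS (x , _) = Known x

  KnownE : SEnd → Set
  KnownE (s , s′) = KnownS s × KnownS s′

  KnownSite : Site → Set
  KnownSite (eL , eR) = KnownE eL × KnownE eR

  KnownM : SMonomer → Set
  KnownM (smono a b c d _) = KnownS a × KnownS b × KnownS c × KnownS d

  ιs-injective : ∀ x y → KnownS x → KnownS y → ιs x ≡ ιs y → x ≡ y
  ιs-injective (x , b) (y , c) kx ky e with enc-injective x y kx ky (cong proj₁ e) | cong proj₂ e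
  ... | refl | refl = refl

  reflect : ∀ a b c d mm → KnownSite ((a , b) , (c , d)) → KnownM mm →
            CanInsert (ιE (a , b)) (ιE (c , d)) (ιM mm) → Insertable ((a , b) , (c , d)) mm
  reflect a b c d mm ((ka , kb) , (kc , kd)) (k₁ , k₂ , k₃ , k₄) (inj₁ (e₁ , e₂ , e₃ , e₄)) =
    inj₁ (ιs-injective (cmp a) d ka kd e₁ , e₂ ,
          ιs-injective (sa mm) (cmp b) k₁ kb e₃ , ιs-injective (sd mm) (cmp c) k₄ kc e₄)
  reflect a b c d mm ((ka , kb) , (kc , kd)) (k₁ , k₂ , k₃ , k₄) (inj₂ (e₁ , e₂ , e₃ , e₄)) =
    inj₂ (ιs-injective (cmp b) c kb kc e₁ , e₂ ,
          ιs-injective (sb mm) (cmp a) k₂ ka e₃ , ιs-injective (sc mm) (cmp d) k₃ kd e₄)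

  -- A syntactic test that soundly refutes insertions: equal symbols have equal
  -- shapes (letter constructor and star), and shapes are compared by evaluation,
  -- so impossible insertions are refuted even when the integers are unknown.
  tag : Letter → ℕ
  tag (int _) = 0
  tag (lft _) = 1
  tag (rgt _) = 2
  tag (ter _) = 3
  tag hole    = 4
  tag pad     = 5
  tag trap    = 6
  tag loop    = 7

  shape : Symb → ℕ
  shape (x , false) = tag x
  shape (x , true)  = 8 + tag x

  sameShape : Symb → Symb → Bool
  sameShape x y = shape x ≡ᵇ shape y

  isPlus isMinus : Sign → Bool
  isPlus plus   = true
  isPlus minus  = false
  isMinus plus  = false
  isMinus minus = true

  possible : Site → SMonomer → Bool
  possible ((a , b) , (c , d)) mm =
      (sameShape (cmp a) d ∧ isPlus (ssign mm)  ∧ sameShape (sa mm) (cmp b) ∧ sameShape (sd mm) (cmp c))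
    ∨ (sameShape (cmp b) c ∧ isMinus (ssign mm) ∧ sameShape (sb mm) (cmp a) ∧ sameShape (sc mm) (cmp d))

  sameShape-≡ : ∀ {x y} → x ≡ y → T (sameShape x y)
  sameShape-≡ {x} refl = ℕₚ.≡⇒≡ᵇ (shape x) (shape x) refl

  T-∧⁴ : ∀ {p q r s} → T p → T q → T r → T s → T (p ∧ q ∧ r ∧ s)
  T-∧⁴ tp tq tr ts = Equivalence.from T-∧ (tp , Equivalence.from T-∧ (tq , Equivalence.from T-∧ (tr , ts)))

  possible-complete : ∀ s mm → Insertable s mm → T (possible s mm)
  possible-complete ((a , b) , (c , d)) mm (inj₁ (e₁ , e₂ , e₃ , e₄)) =
    Equivalence.from T-∨ (inj₁ (T-∧⁴ (sameShape-≡ e₁) (subst (λ σ → T (isPlus σ)) (sym e₂) tt)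
                                     (sameShape-≡ e₃) (sameShape-≡ e₄)))
  possible-complete ((a , b) , (c , d)) mm (inj₂ (e₁ , e₂ , e₃ , e₄)) =
    Equivalence.from T-∨ (inj₂ (T-∧⁴ (sameShape-≡ e₁) (subst (λ σ → T (isMinus σ)) (sym e₂) tt)
                                     (sameShape-≡ e₃) (sameShape-≡ e₄)))

  refute : ∀ {s mm} → possible s mm ≡ false → ¬ Insertable s mm
  refute {s} {mm} impossible ins = subst T impossible (possible-complete s mm ins)

  -- A region (int a , hole)(hole* , int d) stands for the
  -- non-terminal (a,d).  A binary rule (a,d) → (a,b)(c,d) inserts binaryM, whose
  -- two new sites are closed off by openLeft b and openRight c into regions for
  -- (a,b) and (c,d); a unary rule (a,d) → t inserts unaryM, which carries t and
  -- closes its region.  trapM can always be inserted into a region and starts an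
  -- endless chain loopM, loopM′ a, loopM, …, so that no terminal polymer leaves a
  -- region unexpanded or uses the trap.
  binaryM : ℤ → ℤ → ℤ → ℤ → SMonomer
  binaryM a b c d = smono (○ lft b) (● int a) (● int d) (○ rgt c) minus

  openLeft : ℤ → SMonomer
  openLeft b = smono (● hole) (○ int b) (○ pad) (● lft b) plus

  openRight : ℤ → SMonomer
  openRight c = smono (● rgt c) (○ pad) (○ int c) (○ hole) plus

  unaryM : ℤ → ℤ → Fin m → SMonomer
  unaryM a d t = smono (○ ter t) (● int a) (● int d) (○ pad) minus

  trapM : ℤ → ℤ → SMonomer
  trapM a d = smono (○ trap) (● int a) (● int d) (○ pad) minus

  loopM : SMonomer
  loopM = smono (● hole) (○ pad) (○ loop) (● trap) plus

  loopM′ : ℤ → SMonomer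
  loopM′ a = smono (○ pad) (● loop) (○ int a) (○ hole) minus

  data Family : SMonomer → Set where
    binaryF    : ∀ {a b c d} → binary a b c d ∈ Δ → Family (binaryM a b c d)
    openLeftF  : ∀ {a b c d} → binary a b c d ∈ Δ → Family (openLeft b)
    openRightF : ∀ {a b c d} → binary a b c d ∈ Δ → Family (openRight c)
    unaryF     : ∀ {a d t} → unary a d t ∈ Δ → Family (unaryM a d t)
    trapF      : ∀ {a d} → (a , d) ∈ Γ → Family (trapM a d)
    loopF      : Family loopM
    loopF′     : ∀ {a d} → (a , d) ∈ Γ → Family (loopM′ a)

  ruleMonomers : Rule m → List SMonomer
  ruleMonomers (binary a b c d) = binaryM a b c d ∷ openLeft b ∷ openRight c ∷ []
  ruleMonomers (unary a d t)    = unaryM a d t ∷ []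

  trapMonomers : NT → List SMonomer
  trapMonomers (a , d) = trapM a d ∷ loopM′ a ∷ []

  monomers : List SMonomer
  monomers = loopM ∷ concatMap ruleMonomers Δ ++ concatMap trapMonomers Γ

  Family⇒∈ : ∀ {mm} → Family mm → mm ∈ monomers
  Family⇒∈ (binaryF r∈)    = there (∈-++⁺ˡ (∈-concatMap-at r∈ (here refl)))
  Family⇒∈ (openLeftF r∈)  = there (∈-++⁺ˡ (∈-concatMap-at r∈ (there (here refl))))
  Family⇒∈ (openRightF r∈) = there (∈-++⁺ˡ (∈-concatMap-at r∈ (there (there (here refl)))))
  Family⇒∈ (unaryF r∈)     = there (∈-++⁺ˡ (∈-concatMap-at r∈ (here refl)))
  Family⇒∈ (trapF x∈)      = there (∈-++⁺ʳ (concatMap ruleMonomers Δ) (∈-concatMap-at x∈ (here refl)))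
  Family⇒∈ loopF           = here refl
  Family⇒∈ (loopF′ x∈)     = there (∈-++⁺ʳ (concatMap ruleMonomers Δ) (∈-concatMap-at x∈ (there (here refl))))

  ∈⇒Family : ∀ {mm} → mm ∈ monomers → Family mm
  ∈⇒Family (here refl) = loopF
  ∈⇒Family (there mm∈) with ∈-++⁻ (concatMap ruleMonomers Δ) mm∈
  ... | inj₁ ∈rules with find (∈-concatMap⁻ ruleMonomers {xs = Δ} ∈rules)
  ...   | binary a b c d , r∈ , here refl                 = binaryF r∈
  ...   | binary a b c d , r∈ , there (here refl)         = openLeftF r∈
  ...   | binary a b c d , r∈ , there (there (here refl)) = openRightF r∈
  ...   | unary a d t    , r∈ , here refl                 = unaryF r∈
  ∈⇒Family (there mm∈) | inj₂ ∈traps with find (∈-concatMap⁻ trapMonomers {xs = Γ} ∈traps)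
  ...   | (a , d) , x∈ , here refl         = trapF x∈
  ...   | (a , d) , x∈ , there (here refl) = loopF′ x∈

  knownFamily : ∀ {mm} → Family mm → KnownM mm
  knownFamily (binaryF r∈)    = known₂ (leftChild∈Γ r∈) , known₁ (lhs∈Γ r∈) , known₂ (lhs∈Γ r∈) , known₁ (rightChild∈Γ r∈)
  knownFamily (openLeftF r∈)  = tt , known₂ (leftChild∈Γ r∈) , tt , known₂ (leftChild∈Γ r∈)
  knownFamily (openRightF r∈) = known₁ (rightChild∈Γ r∈) , tt , known₁ (rightChild∈Γ r∈) , tt
  knownFamily (unaryF r∈)     = tt , known₁ (unary∈Γ r∈) , known₂ (unary∈Γ r∈) , tt
  knownFamily (trapF x∈)      = tt , known₁ x∈ , known₂ x∈ , tt
  knownFamily loopF           = tt , tt , tt , tt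
  knownFamily (loopF′ x∈)     = tt , tt , known₁ x∈ , tt

  -- The insertion system: initiator (int S₁ , hole)(hole* , int S₂), i.e. a region for S.
  ntL : ℤ → SEnd
  ntL a = ○ int a , ○ hole

  ntR : ℤ → SEnd
  ntR d = ● hole , ○ int d

  system : InsSystem K
  system = record
    { Δ'           = withConcentrations (map ιM monomers)
    ; conc-pos     = concentrations-pos (map ιM monomers)
    ; conc-le1     = concentrations-≤1 (map ιM monomers)
    ; conc-sum     = concentrations-sum (map ιM monomers)
    ; Q            = ιE (ntL (proj₁ S))
    ; R            = ιE (ntR (proj₂ S))
    ; initiator-ok = inj₂ refl
    }
    where open Concentrations

  Family⇒type : ∀ {mm} → Family mm → IsType system (ιM mm)
  Family⇒type f = Concentrations.∈⇒typed (map ιM monomers) (∈-map⁺ ιM (Family⇒∈ f))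

  type⇒Family : ∀ {mo} → IsType system mo → ∃[ mm ] Family mm × mo ≡ ιM mm
  type⇒Family ty with ∈-map⁻ ιM (Concentrations.typed⇒∈ (map ιM monomers) ty)
  ... | mm , mm∈ , refl = mm , ∈⇒Family mm∈ , refl

  ntSite : ℤ → ℤ → Site
  ntSite a d = ntL a , ntR d

  -- left / right of binaryM a b c d, before openLeft b / openRight c is inserted
  leftSite : ℤ → ℤ → Site
  leftSite b a = ntL a , (○ lft b , ● int a)

  rightSite : ℤ → ℤ → Site
  rightSite c d = (● int d , ○ rgt c) , ntR d

  trapSite : ℤ → Site
  trapSite a = ntL a , (○ trap , ● int a)

  loopSite : ℤ → Site
  loopSite a = (○ loop , ● trap) , (○ trap , ● int a)

  -- dead sites: right of openLeft, left of openRight, and left / right of unaryM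
  afterOpenLeft : ℤ → ℤ → Site
  afterOpenLeft b a = (○ pad , ● lft b) , (○ lft b , ● int a)

  beforeOpenRight : ℤ → ℤ → Site
  beforeOpenRight c d = (● int d , ○ rgt c) , (● rgt c , ○ pad)

  beforeTerminal : ℤ → Fin m → Site
  beforeTerminal a t = ntL a , (○ ter t , ● int a)

  afterPad : ℤ → Site
  afterPad d = (● int d , ○ pad) , ntR d

  data AtRegion (a d : ℤ) : SMonomer → Set where
    viaBinary : ∀ {b c} → binary a b c d ∈ Δ → AtRegion a d (binaryM a b c d)
    viaUnary  : ∀ {t} → unary a d t ∈ Δ → AtRegion a d (unaryM a d t)
    viaTrap   : AtRegion a d (trapM a d)

  atRegion : ∀ {a d mm} → Family mm → Insertable (ntSite a d) mm → AtRegion a d mm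
  atRegion (binaryF r∈)   (inj₂ (refl , refl , refl , refl)) = viaBinary r∈
  atRegion (binaryF _)    (inj₁ (() , _))
  atRegion (unaryF r∈)    (inj₂ (refl , refl , refl , refl)) = viaUnary r∈
  atRegion (unaryF _)     (inj₁ (() , _))
  atRegion (trapF _)      (inj₂ (refl , refl , refl , refl)) = viaTrap
  atRegion (trapF _)      (inj₁ (() , _))
  atRegion (openLeftF _)  ins = ⊥-elim (refute refl ins)
  atRegion (openRightF _) ins = ⊥-elim (refute refl ins)
  atRegion loopF          ins = ⊥-elim (refute refl ins)
  atRegion (loopF′ _)     ins = ⊥-elim (refute refl ins)

  atLeft : ∀ {a b mm} → Family mm → Insertable (leftSite b a) mm → mm ≡ openLeft b
  atLeft (openLeftF _)  (inj₁ (refl , refl , refl , refl)) = refl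
  atLeft (openLeftF _)  (inj₂ (() , _))
  atLeft (binaryF _)    ins = ⊥-elim (refute refl ins)
  atLeft (openRightF _) ins = ⊥-elim (refute refl ins)
  atLeft (unaryF _)     ins = ⊥-elim (refute refl ins)
  atLeft (trapF _)      ins = ⊥-elim (refute refl ins)
  atLeft loopF          ins = ⊥-elim (refute refl ins)
  atLeft (loopF′ _)     ins = ⊥-elim (refute refl ins)

  atRight : ∀ {c d mm} → Family mm → Insertable (rightSite c d) mm → mm ≡ openRight c
  atRight (openRightF _) (inj₁ (refl , refl , refl , refl)) = refl
  atRight (openRightF _) (inj₂ (() , _))
  atRight (binaryF _)    ins = ⊥-elim (refute refl ins)
  atRight (openLeftF _)  ins = ⊥-elim (refute refl ins)
  atRight (unaryF _)     ins = ⊥-elim (refute refl ins)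
  atRight (trapF _)      ins = ⊥-elim (refute refl ins)
  atRight loopF          ins = ⊥-elim (refute refl ins)
  atRight (loopF′ _)     ins = ⊥-elim (refute refl ins)

  atTrap : ∀ {a mm} → Family mm → Insertable (trapSite a) mm → mm ≡ loopM
  atTrap loopF          (inj₁ (refl , refl , refl , refl)) = refl
  atTrap loopF          (inj₂ (() , _))
  atTrap (binaryF _)    ins = ⊥-elim (refute refl ins)
  atTrap (openLeftF _)  ins = ⊥-elim (refute refl ins)
  atTrap (openRightF _) ins = ⊥-elim (refute refl ins)
  atTrap (unaryF _)     ins = ⊥-elim (refute refl ins)
  atTrap (trapF _)      ins = ⊥-elim (refute refl ins)
  atTrap (loopF′ _)     ins = ⊥-elim (refute refl ins)

  atLoop : ∀ {a mm} → Family mm → Insertable (loopSite a) mm → mm ≡ loopM′ a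
  atLoop (loopF′ _)     (inj₂ (refl , refl , refl , refl)) = refl
  atLoop (loopF′ _)     (inj₁ (() , _))
  atLoop (binaryF _)    ins = ⊥-elim (refute refl ins)
  atLoop (openLeftF _)  ins = ⊥-elim (refute refl ins)
  atLoop (openRightF _) ins = ⊥-elim (refute refl ins)
  atLoop (unaryF _)     ins = ⊥-elim (refute refl ins)
  atLoop (trapF _)      ins = ⊥-elim (refute refl ins)
  atLoop loopF          ins = ⊥-elim (refute refl ins)

  Dead : Site → Set
  Dead s = ∀ {mm} → Family mm → ¬ Insertable s mm

  dead-afterOpenLeft : ∀ b a → Dead (afterOpenLeft b a)
  dead-afterOpenLeft b a (binaryF _)    = refute refl
  dead-afterOpenLeft b a (openLeftF _)  = refute refl
  dead-afterOpenLeft b a (openRightF _) = refute refl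
  dead-afterOpenLeft b a (unaryF _)     = refute refl
  dead-afterOpenLeft b a (trapF _)      = refute refl
  dead-afterOpenLeft b a loopF          = refute refl
  dead-afterOpenLeft b a (loopF′ _)     = refute refl

  dead-beforeOpenRight : ∀ c d → Dead (beforeOpenRight c d)
  dead-beforeOpenRight c d (binaryF _)    = refute refl
  dead-beforeOpenRight c d (openLeftF _)  = refute refl
  dead-beforeOpenRight c d (openRightF _) = refute refl
  dead-beforeOpenRight c d (unaryF _)     = refute refl
  dead-beforeOpenRight c d (trapF _)      = refute refl
  dead-beforeOpenRight c d loopF          = refute refl
  dead-beforeOpenRight c d (loopF′ _)     = refute refl

  dead-beforeTerminal : ∀ a t → Dead (beforeTerminal a t)
  dead-beforeTerminal a t (binaryF _)    = refute refl
  dead-beforeTerminal a t (openLeftF _)  = refute refl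
  dead-beforeTerminal a t (openRightF _) = refute refl
  dead-beforeTerminal a t (unaryF _)     = refute refl
  dead-beforeTerminal a t (trapF _)      = refute refl
  dead-beforeTerminal a t loopF          = refute refl
  dead-beforeTerminal a t (loopF′ _)     = refute refl

  dead-afterPad : ∀ d → Dead (afterPad d)
  dead-afterPad d (binaryF _)    = refute refl
  dead-afterPad d (openLeftF _)  = refute refl
  dead-afterPad d (openRightF _) = refute refl
  dead-afterPad d (unaryF _)     = refute refl
  dead-afterPad d (trapF _)      = refute refl
  dead-afterPad d loopF          = refute refl
  dead-afterPad d (loopF′ _)     = refute refl

module Correctness (m : ℕ) (G : IPGrammar m) where
  open IPGrammar G
  open Construction m G
  open SMonomer
  open InsertionTrees system

  CT : Site → Polymer K → Set
  CT (eL , eR) = ClosedTree (ιE eL) (ιE eR)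

  data InsertedAt (s : Site) : Monomer K → Set where
    inserted : ∀ {mm} → Family mm → Insertable s mm → InsertedAt s (ιM mm)

  insertedAt : ∀ {eL eR mo} → KnownSite (eL , eR) → IsType system mo →
               CanInsert (ιE eL) (ιE eR) mo → InsertedAt (eL , eR) mo
  insertedAt {(a , b)} {(c , d)} k ty ins with type⇒Family ty
  ... | mm , f , refl = inserted f (reflect a b c d mm k (knownFamily f) ins)

  dead-closed : ∀ {eL eR} → KnownSite (eL , eR) → Dead (eL , eR) → Closed (ιE eL) (ιE eR)
  dead-closed k dead mo ty ins with insertedAt k ty ins
  ... | inserted f ins′ = dead f ins′

  dead-empty : ∀ {s P} → KnownSite s → Dead s → CT s P → P ≡ []
  dead-empty k dead (leaf _)          = refl
  dead-empty k dead (node ty ins _ _) = ⊥-elim (dead-closed k dead _ ty ins)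

  g : Sym K → Maybe (Fin m)
  g (i , true)  = nothing
  g (i , false) = terminal (dec i)

  g-○ : ∀ x → g (ιs (○ x)) ≡ terminal x
  g-○ x = terminal-dec-enc x

  -- all erased-symbol runs have length at most 15
  open Density g 15

  syms : Polymer K → List (Sym K)
  syms = concatMap monoSyms

  word : Polymer K → List (Fin m)
  word P = mapMaybe g (syms P)

  syms-node : ∀ P₁ mo P₂ → syms (P₁ ++ mo ∷ P₂) ≡ syms P₁ ++ monoSyms mo ++ syms P₂
  syms-node P₁ mo P₂ = concatMap-++ monoSyms P₁ (mo ∷ P₂)

  word-erased-node : ∀ P₁ mo P₂ → All Erased (monoSyms mo) → word (P₁ ++ mo ∷ P₂) ≡ word P₁ ++ word P₂
  word-erased-node P₁ mo P₂ er = begin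
    mapMaybe g (syms (P₁ ++ mo ∷ P₂))                           ≡⟨ cong (mapMaybe g) (syms-node P₁ mo P₂) ⟩
    mapMaybe g (syms P₁ ++ monoSyms mo ++ syms P₂)              ≡⟨ mapMaybe-++ g (syms P₁) _ ⟩
    word P₁ ++ mapMaybe g (monoSyms mo ++ syms P₂)              ≡⟨ cong (word P₁ ++_) (mapMaybe-++ g (monoSyms mo) (syms P₂)) ⟩
    word P₁ ++ mapMaybe g (monoSyms mo) ++ word P₂              ≡⟨ cong (λ w → word P₁ ++ w ++ word P₂) (erase (monoSyms mo) er) ⟩
    word P₁ ++ word P₂                                          ∎
    where open ≡-Reasoning

  erased-binaryM : ∀ a b c d → All Erased (monoSyms (ιM (binaryM a b c d)))
  erased-binaryM a b c d = g-○ (lft b) ∷ refl ∷ refl ∷ g-○ (rgt c) ∷ []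

  erased-openLeft : ∀ b → All Erased (monoSyms (ιM (openLeft b)))
  erased-openLeft b = refl ∷ g-○ (int b) ∷ g-○ pad ∷ refl ∷ []

  erased-openRight : ∀ c → All Erased (monoSyms (ιM (openRight c)))
  erased-openRight c = refl ∷ g-○ pad ∷ g-○ (int c) ∷ g-○ hole ∷ []

  erased-unaryM-tail : ∀ a d → All Erased (ιs (● int a) ∷ ιs (● int d) ∷ ιs (○ pad) ∷ [])
  erased-unaryM-tail a d = refl ∷ refl ∷ g-○ pad ∷ []

  word-binaryM : ∀ a b c d P₁ P₂ → word (P₁ ++ ιM (binaryM a b c d) ∷ P₂) ≡ word P₁ ++ word P₂
  word-binaryM a b c d P₁ P₂ = word-erased-node P₁ _ P₂ (erased-binaryM a b c d)

  word-openLeft : ∀ b P₁ → word (P₁ ++ ιM (openLeft b) ∷ []) ≡ word P₁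
  word-openLeft b P₁ = trans (word-erased-node P₁ _ [] (erased-openLeft b)) (++-identityʳ (word P₁))

  word-openRight : ∀ c P₂ → word (ιM (openRight c) ∷ P₂) ≡ word P₂
  word-openRight c P₂ = word-erased-node [] (ιM (openRight c)) P₂ (erased-openRight c)

  word-unaryM : ∀ a d t → word (ιM (unaryM a d t) ∷ []) ≡ t ∷ []
  word-unaryM a d t rewrite g-○ (ter t) | erase (ιs (● int a) ∷ ιs (● int d) ∷ ιs (○ pad) ∷ []) (erased-unaryM-tail a d) = refl

  -- density of the pieces: a region's string starts with a terminal and ends
  -- with at most 3 erased symbols; the other pieces add 4 erased symbols each
  good-binaryM : ∀ a b c d P₁ P₂ → Good 15 7 (syms P₁) → Good 11 3 (syms P₂) →
                 Good 15 3 (syms (P₁ ++ ιM (binaryM a b c d) ∷ P₂))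
  good-binaryM a b c d P₁ P₂ g₁ g₂ =
    subst (Good 15 3) (sym (syms-node P₁ _ P₂))
      (Good-++ (syms P₁) _ g₁
        (Good-++ (monoSyms (ιM (binaryM a b c d))) (syms P₂) (Good-erased 7 (monoSyms (ιM (binaryM a b c d))) (erased-binaryM a b c d) (ℕₚ.≤ᵇ⇒≤ 11 15 _)) g₂ ℕₚ.≤-refl)
        ℕₚ.≤-refl)

  good-openLeft : ∀ b P₁ → Good 15 3 (syms P₁) → Good 15 7 (syms (P₁ ++ ιM (openLeft b) ∷ []))
  good-openLeft b P₁ g₁ =
    subst (Good 15 7) (sym (syms-node P₁ _ []))
      (Good-++ (syms P₁) (monoSyms (ιM (openLeft b))) g₁ (Good-erased 3 (monoSyms (ιM (openLeft b))) (erased-openLeft b) (ℕₚ.≤ᵇ⇒≤ 7 15 _)) ℕₚ.≤-refl)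

  good-openRight : ∀ c P₂ → Good 15 3 (syms P₂) → Good 11 3 (syms (ιM (openRight c) ∷ P₂))
  good-openRight c P₂ g₂ =
    Good-++ (monoSyms (ιM (openRight c))) (syms P₂) (Good-erased 11 (monoSyms (ιM (openRight c))) (erased-openRight c) ℕₚ.≤-refl) g₂ ℕₚ.≤-refl

  good-unaryM : ∀ a d t → Good 15 3 (syms (ιM (unaryM a d t) ∷ []))
  good-unaryM a d t =
    Good-letter {x = ιs (○ ter t)} tail (g-○ (ter t)) (Good-erased 0 tail (erased-unaryM-tail a d) (ℕₚ.≤ᵇ⇒≤ 3 15 _))
    where tail = ιs (● int a) ∷ ιs (● int d) ∷ ιs (○ pad) ∷ []

  known-ntSite : ∀ {a d} → (a , d) ∈ Γ → KnownSite (ntSite a d)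
  known-ntSite x∈ = (known₁ x∈ , tt) , (tt , known₂ x∈)

  known-leftSite : ∀ {a b} → (a , b) ∈ Γ → KnownSite (leftSite b a)
  known-leftSite x∈ = (known₁ x∈ , tt) , (known₂ x∈ , known₁ x∈)

  known-rightSite : ∀ {c d} → (c , d) ∈ Γ → KnownSite (rightSite c d)
  known-rightSite x∈ = (known₂ x∈ , known₁ x∈) , (tt , known₂ x∈)

  known-trapSite : ∀ {a d} → (a , d) ∈ Γ → KnownSite (trapSite a)
  known-trapSite x∈ = (known₁ x∈ , tt) , (tt , known₁ x∈)

  known-loopSite : ∀ {a d} → (a , d) ∈ Γ → KnownSite (loopSite a)
  known-loopSite x∈ = (tt , tt) , (tt , known₁ x∈)

  known-afterOpenLeft : ∀ {a b} → (a , b) ∈ Γ → KnownSite (afterOpenLeft b a)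
  known-afterOpenLeft x∈ = (tt , known₂ x∈) , (known₂ x∈ , known₁ x∈)

  known-beforeOpenRight : ∀ {c d} → (c , d) ∈ Γ → KnownSite (beforeOpenRight c d)
  known-beforeOpenRight x∈ = (known₂ x∈ , known₁ x∈) , (known₁ x∈ , tt)

  known-beforeTerminal : ∀ {a d} t → (a , d) ∈ Γ → KnownSite (beforeTerminal a t)
  known-beforeTerminal t x∈ = (known₁ x∈ , tt) , (tt , known₁ x∈)

  known-afterPad : ∀ {a d} → (a , d) ∈ Γ → KnownSite (afterPad d)
  known-afterPad x∈ = (known₂ x∈ , tt) , (tt , known₂ x∈)

  -- What a closed tree over the region of x yields: a derivation of its word
  -- from x, and a string with entry bound s and exit bound e for erased runs.
  record Sound (x : NT) (s e : ℕ) (P : Polymer K) : Set where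
    constructor sound
    field
      derivation : Derives G x (word P)
      good       : Good s e (syms P)

  binarySound : ∀ {a b c d P₁ P₂} → binary a b c d ∈ Δ → Sound (a , b) 15 7 P₁ → Sound (c , d) 11 3 P₂ →
                Sound (a , d) 15 3 (P₁ ++ ιM (binaryM a b c d) ∷ P₂)
  binarySound {a} {b} {c} {d} {P₁} {P₂} r∈ (sound d₁ g₁) (sound d₂ g₂) =
    sound (subst (Derives G (a , d)) (sym (word-binaryM a b c d P₁ P₂)) (der-binary r∈ d₁ d₂))
          (good-binaryM a b c d P₁ P₂ g₁ g₂)

  unarySound : ∀ {a d t P₁ P₂} → unary a d t ∈ Δ → P₁ ≡ [] → P₂ ≡ [] →
               Sound (a , d) 15 3 (P₁ ++ ιM (unaryM a d t) ∷ P₂)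
  unarySound {a} {d} {t} r∈ refl refl =
    sound (subst (Derives G (a , d)) (sym (word-unaryM a d t)) (der-unary r∈)) (good-unaryM a d t)

  openLeftSound : ∀ {x b P₁ P₂} → Sound x 15 3 P₁ → P₂ ≡ [] → Sound x 15 7 (P₁ ++ ιM (openLeft b) ∷ P₂)
  openLeftSound {x} {b} {P₁} (sound d₁ g₁) refl =
    sound (subst (Derives G x) (sym (word-openLeft b P₁)) d₁) (good-openLeft b P₁ g₁)

  openRightSound : ∀ {x c P₁ P₂} → P₁ ≡ [] → Sound x 15 3 P₂ → Sound x 11 3 (P₁ ++ ιM (openRight c) ∷ P₂)
  openRightSound {x} {c} {P₂ = P₂} refl (sound d₂ g₂) =
    sound (subst (Derives G x) (sym (word-openRight c P₂)) d₂) (good-openRight c P₂ g₂)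

  -- Soundness, by induction on closed trees.  A region is never a closed leaf
  -- (trapM fits), and the trap chain has no finite closed tree.
  mutual
    regionSound : ∀ {a d P} → (a , d) ∈ Γ → CT (ntSite a d) P → Sound (a , d) 15 3 P
    regionSound x∈ (leaf closed) =
      ⊥-elim (closed _ (Family⇒type (trapF x∈)) (inj₂ (refl , refl , refl , refl)))
    regionSound {a} {d} x∈ (node ty ins tl tr) with insertedAt (known-ntSite x∈) ty ins
    ... | inserted f ins′ with atRegion {a} {d} f ins′
    ...   | viaBinary r∈ = binarySound r∈ (leftSound r∈ tl) (rightSound r∈ tr)
    ...   | viaUnary {t} r∈ =
      unarySound r∈ (dead-empty (known-beforeTerminal t x∈) (dead-beforeTerminal _ t) tl)
                    (dead-empty (known-afterPad x∈) (dead-afterPad _) tr)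
    ...   | viaTrap = ⊥-elim (trapStuck x∈ tl)

    leftSound : ∀ {a b c d P} → binary a b c d ∈ Δ → CT (leftSite b a) P → Sound (a , b) 15 7 P
    leftSound r∈ (leaf closed) =
      ⊥-elim (closed _ (Family⇒type (openLeftF r∈)) (inj₁ (refl , refl , refl , refl)))
    leftSound {a} {b} r∈ (node ty ins tl tr) with insertedAt (known-leftSite (leftChild∈Γ r∈)) ty ins
    ... | inserted f ins′ with refl ← atLeft {a} {b} f ins′ =
      openLeftSound (regionSound (leftChild∈Γ r∈) tl)
        (dead-empty (known-afterOpenLeft (leftChild∈Γ r∈)) (dead-afterOpenLeft _ _) tr)

    rightSound : ∀ {a b c d P} → binary a b c d ∈ Δ → CT (rightSite c d) P → Sound (c , d) 11 3 P
    rightSound r∈ (leaf closed) =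
      ⊥-elim (closed _ (Family⇒type (openRightF r∈)) (inj₁ (refl , refl , refl , refl)))
    rightSound {c = c} {d} r∈ (node ty ins tl tr) with insertedAt (known-rightSite (rightChild∈Γ r∈)) ty ins
    ... | inserted f ins′ with refl ← atRight {c} {d} f ins′ =
      openRightSound (dead-empty (known-beforeOpenRight (rightChild∈Γ r∈)) (dead-beforeOpenRight _ _) tl)
        (regionSound (rightChild∈Γ r∈) tr)

    trapStuck : ∀ {a d P} → (a , d) ∈ Γ → CT (trapSite a) P → ⊥
    trapStuck x∈ (leaf closed) = closed _ (Family⇒type loopF) (inj₁ (refl , refl , refl , refl))
    trapStuck {a} x∈ (node ty ins tl tr) with insertedAt (known-trapSite x∈) ty ins
    ... | inserted f ins′ with refl ← atTrap {a} f ins′ = loopStuck x∈ tr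

    loopStuck : ∀ {a d P} → (a , d) ∈ Γ → CT (loopSite a) P → ⊥
    loopStuck x∈ (leaf closed) = closed _ (Family⇒type (loopF′ x∈)) (inj₂ (refl , refl , refl , refl))
    loopStuck {a} x∈ (node ty ins tl tr) with insertedAt (known-loopSite x∈) ty ins
    ... | inserted f ins′ with refl ← atLoop {a} f ins′ = trapStuck x∈ tr

  realize : ∀ {x w} → Derives G x w → ∃[ P ] CT (ntSite (proj₁ x) (proj₂ x)) P × word P ≡ w
  realize (der-unary {a} {d} {t} r∈) =
    ιM (unaryM a d t) ∷ [] ,
    node (Family⇒type (unaryF r∈)) (inj₂ (refl , refl , refl , refl))
      (leaf (dead-closed (known-beforeTerminal t (unary∈Γ r∈)) (dead-beforeTerminal a t)))
      (leaf (dead-closed (known-afterPad (unary∈Γ r∈)) (dead-afterPad d))) ,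
    word-unaryM a d t
  realize (der-binary {a} {b} {c} {d} r∈ d₁ d₂) with realize d₁ | realize d₂
  ... | P₁ , t₁ , w₁ | P₂ , t₂ , w₂ =
    (P₁ ++ ιM (openLeft b) ∷ []) ++ ιM (binaryM a b c d) ∷ ιM (openRight c) ∷ P₂ ,
    node (Family⇒type (binaryF r∈)) (inj₂ (refl , refl , refl , refl))
      (node (Family⇒type (openLeftF r∈)) (inj₁ (refl , refl , refl , refl)) t₁
        (leaf (dead-closed (known-afterOpenLeft (leftChild∈Γ r∈)) (dead-afterOpenLeft b a))))
      (node (Family⇒type (openRightF r∈)) (inj₁ (refl , refl , refl , refl))
        (leaf (dead-closed (known-beforeOpenRight (rightChild∈Γ r∈)) (dead-beforeOpenRight c d))) t₂) ,
    trans (word-binaryM a b c d (P₁ ++ ιM (openLeft b) ∷ []) (ιM (openRight c) ∷ P₂))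
          (cong₂ _++_ (trans (word-openLeft b P₁) w₁) (trans (word-openRight c P₂) w₂))

  terminalSound : ∀ {P} → Constructed system P → Terminal system P → Sound S 15 3 P
  terminalSound c term = regionSound S∈Γ (terminal⇒closedTree (constructed⇒tree c) term)

  -- The initiator's symbols are erased, so the string of a polymer has the polymer's word
  -- and, being padded by two erased symbols on either side, stays dense.
  initiatorL initiatorR : List (Sym K)
  initiatorL = ιs (○ int (proj₁ S)) ∷ ιs (○ hole) ∷ []
  initiatorR = ιs (● hole) ∷ ιs (○ int (proj₂ S)) ∷ []

  erased-initiatorL : All Erased initiatorL
  erased-initiatorL = g-○ (int (proj₁ S)) ∷ g-○ hole ∷ []

  erased-initiatorR : All Erased initiatorR
  erased-initiatorR = refl ∷ g-○ (int (proj₂ S)) ∷ []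

  word-string : ∀ P → mapMaybe g (stringRep system P) ≡ word P
  word-string P = begin
    mapMaybe g (initiatorL ++ syms P ++ initiatorR)                 ≡⟨ mapMaybe-++ g initiatorL (syms P ++ initiatorR) ⟩
    mapMaybe g initiatorL ++ mapMaybe g (syms P ++ initiatorR)     ≡⟨ cong₂ _++_ (erase initiatorL erased-initiatorL)
                                                                          (mapMaybe-++ g (syms P) initiatorR) ⟩
    word P ++ mapMaybe g initiatorR                                ≡⟨ cong (word P ++_) (erase initiatorR erased-initiatorR) ⟩
    word P ++ []                                                   ≡⟨ ++-identityʳ (word P) ⟩
    word P                                                         ∎
    where open ≡-Reasoning

  bounded-string : ∀ P → Good 15 3 (syms P) → Bounded 0 (stringRep system P)
  bounded-string P gP =
    proj₁ (Good-++ initiatorL (syms P ++ initiatorR) (Good-erased 0 initiatorL erased-initiatorL (ℕₚ.≤ᵇ⇒≤ 2 15 _))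
             (Good-++ (syms P) initiatorR gP (Good-erased 3 initiatorR erased-initiatorR (ℕₚ.≤ᵇ⇒≤ 5 15 _)) ℕₚ.≤-refl)
             (ℕₚ.≤ᵇ⇒≤ 2 15 _) 0 z≤n)

  expresses : Expresses system G
  expresses = g , 16 , s≤s z≤n , language , windows
    where
      language : ∀ w → InLangG G w ⇔ (∃[ s ] (InLangS system s × mapMaybe g s ≡ w))
      language w = mk⇔ complete sound′
        where
          complete : InLangG G w → ∃[ s ] (InLangS system s × mapMaybe g s ≡ w)
          complete dw with realize dw
          ... | P , t , refl =
            stringRep system P , (P , tree⇒constructed (forget t) , closedTree⇒terminal t , refl) , word-string P
          sound′ : ∃[ s ] (InLangS system s × mapMaybe g s ≡ w) → InLangG G w
          sound′ (_ , (P , c , term , refl) , refl) =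
            subst (Derives G S) (sym (word-string P)) (Sound.derivation (terminalSound c term))

      windows : ∀ s u v w → InLangS system s → s ≡ u ++ v ++ w → length v ≡ 16 → Any (λ x → Is-just (g x)) v
      windows _ u v w (P , c , term , refl) =
        dense (stringRep system P) (bounded-string P (Sound.good (terminalSound c term))) u v w

lemma2 : ∀ (m : ℕ) (G : IPGrammar m) → Σ ℕ λ k → Σ (InsSystem k) λ S → Expresses S G
lemma2 m G = K , system , expresses
  where
    open Construction m G using (K; system)
    open Correctness m G using (expresses)
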